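{- For all integers $n\ge1$, $k\ge1$ and $b\ge1$, $$\mathrm{spt}_{(0,b)}(n,k)=\left\lfloor\frac{k\lfloor n/k\rfloor}{n}\right\rfloor\left(k^b-(k-1)^b\right)+\sum_{m=1}^{\lfloor n/k\rfloor}\sum_{\nu=1}^{k-1}(k-\nu)^b\,p(n-km,\nu).$$
   Context: $p(n,k)$ is the number of partitions of $n$ into exactly $k$ positive parts, with the conventions $p(0,1)=1$ and $p(n,k)=0$ if $n<0$, $k<1$, or $k>n$. For a partition $\lambda$, $\sigma(\lambda)$ is its smallest part and $\#(\lambda)$ the number of parts equal to $\sigma(\lambda)$. $\mathrm{spt}_{(a,b)}(n,k)=\sum_{\lambda}\sigma(\lambda)^a\#(\lambda)^b$ over all partitions $\lambda$ of $n$ into exactly $k$ parts. The paper's standing convention is that variables range over positive integers. -}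

module Defs where

open import Data.Nat using (ℕ; zero; suc; _+_; _*_; _∸_; _^_; _≤_; _<_; _≤ᵇ_; _/_; NonZero)
open import Data.List using (List; []; _∷_; map; concatMap; length)
open import Data.Nat.ListAction using (sum)
open import Data.Bool using (Bool; true; false; if_then_else_)

-- A partition is a weakly decreasing list of positive parts (largest first).

-- The extra argument f is fuel (structural recursion); f = n suffices.
partsAtMost : ℕ → ℕ → ℕ → ℕ → List (List ℕ)
partsAtMost f       zero    zero    m = [] ∷ []
partsAtMost f       zero    (suc k) m = []
partsAtMost f       (suc n) zero    m = []
partsAtMost zero    (suc n) (suc k) m = []
partsAtMost (suc f) (suc n) (suc k) m =
  concatMap (λ j → map (λ rest → suc j ∷ rest) (partsAtMost f (suc n ∸ suc j) k (suc j)))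
            (candidates m)
  where
  -- j ranges over 0 .. min(m, suc n) - 1, i.e. first part suc j ∈ [1, min(m, n+1)]
  candidates : ℕ → List ℕ
  candidates zero    = []
  candidates (suc i) = if suc i ≤ᵇ suc n then i ∷ candidates i else candidates i

Partitions : ℕ → ℕ → List (List ℕ)
Partitions n k = partsAtMost n n k n

-- p(n,k) with the paper's conventions: p(0,1) = 1, and p(n,k) = 0 if k < 1 or k > n
-- (the latter are automatic for the counting function).
p : ℕ → ℕ → ℕ
p zero (suc zero) = 1
p n    k          = length (Partitions n k)

-- smallest part σ(λ) and multiplicity #(λ) of the smallest part, for a weakly
-- decreasing list: the smallest part is the last element.
lastOr : ℕ → List ℕ → ℕ
lastOr d []       = d
lastOr d (x ∷ xs) = lastOr x xs

σ : List ℕ → ℕ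
σ λ' = lastOr 0 λ'

countEq : ℕ → List ℕ → ℕ
countEq a []       = 0
countEq a (x ∷ xs) = (if x Data.Nat.≡ᵇ a then 1 else 0) + countEq a xs

# : List ℕ → ℕ
# λ' = countEq (σ λ') λ'

spt : ℕ → ℕ → ℕ → ℕ → ℕ
spt a b n k = sum (map (λ λ' → σ λ' ^ a * # λ' ^ b) (Partitions n k))

sumFrom1 : ℕ → (ℕ → ℕ) → ℕ
sumFrom1 zero    f = 0
sumFrom1 (suc N) f = sumFrom1 N f + f (suc N)

rhs8 : (n k b : ℕ) → .{{_ : NonZero n}} → .{{_ : NonZero k}} → ℕ
rhs8 n k b =
  ((k * (n / k)) / n) * (k ^ b ∸ (k ∸ 1) ^ b)
  + sumFrom1 (n / k) (λ m → sumFrom1 (k ∸ 1) (λ ν → (k ∸ ν) ^ b * p (n ∸ k * m) ν))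

{-# OPTIONS --safe #-}
module Submission where

-- If a partition of n into k parts has smallest part m occurring j times, subtracting m from its
-- other parts leaves a partition of n - k m into k - j parts, and conversely; so
-- spt_(0,b)(n,k) = Σ_{m ≥ 1} Σ_{j=1}^{k} j^b P(n - k m, k - j), where P is the plain count
-- (P(0,0) = 1 and P(0,1) = 0). Putting ν = k - j, this differs from the stated double sum only by
-- the term ν = 0, worth k^b, and by the convention p(0,1) = 1, worth (k-1)^b; both occur only when
-- k m = n, i.e. when k divides n and m = n/k, and ⌊k⌊n/k⌋/n⌋ is exactly the indicator of that case.

open import Defs
open import Data.Bool using (true; false; if_then_else_; T)
open import Data.Empty using (⊥)
open import Data.List using (List; []; _∷_; map; concatMap; filter; length; _++_; replicate)
open import Data.List.Membership.Propositional using (_∈_)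
open import Data.List.Membership.Propositional.Properties
  using (∈-++⁺ˡ; ∈-++⁺ʳ; ∈-++⁻; ∈-map⁺; ∈-map⁻; ∈-filter⁺; ∈-filter⁻)
open import Data.List.Membership.Propositional.Properties.WithK using (unique∧set⇒bag)
open import Data.List.Properties
  using (∷-injectiveʳ; ∷-injectiveˡ; length-++; length-map; length-replicate; map-injective; ++-cancelʳ)
open import Data.List.Relation.Binary.BagAndSetEquality using (∼bag⇒↭)
open import Data.List.Relation.Binary.Permutation.Propositional.Properties using (↭-length)
open import Data.List.Relation.Unary.All using (All; []; _∷_)
import Data.List.Relation.Unary.All as All
import Data.List.Relation.Unary.All.Properties as All
open import Data.List.Relation.Unary.AllPairs using ([]; _∷_)
open import Data.List.Relation.Unary.Any using (here)
open import Data.List.Relation.Unary.Unique.Propositional using (Unique)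
import Data.List.Relation.Unary.Unique.Propositional.Properties as Unique
open import Data.Nat
  using ( ℕ; zero; suc; _+_; _*_; _∸_; _^_; _/_; _≤_; _<_; _≤ᵇ_; _≡ᵇ_; s≤s; s≤s⁻¹; z≤n
        ; NonZero; >-nonZero; >-nonZero⁻¹)
open import Data.Nat.DivMod using (m*n/n≡m; m/n*n≤m; /-monoˡ-≤; n/n≡1; m<n⇒m/n≡0)
open import Data.Nat.ListAction using (sum)
open import Data.Nat.Properties
open import Algebra.Properties.CommutativeSemigroup +-commutativeSemigroup using (interchange)
open import Data.Product using (_×_; _,_; ∃; ∃₂; proj₁)
open import Data.Sum using (_⊎_; inj₁; inj₂)
open import Data.Unit using (tt)
open import Function.Bundles using (mk⇔)
open import Relation.Binary.PropositionalEquality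
open import Relation.Nullary using (does; yes; no; contradiction)
open import Relation.Nullary.Decidable using (dec-true; dec-false)

-- Finite sums

sumFrom1-cong : ∀ N {f h : ℕ → ℕ} → (∀ {i} → 1 ≤ i → i ≤ N → f i ≡ h i) → sumFrom1 N f ≡ sumFrom1 N h
sumFrom1-cong zero    f≡h = refl
sumFrom1-cong (suc N) f≡h =
  cong₂ _+_ (sumFrom1-cong N (λ 1≤i i≤N → f≡h 1≤i (m≤n⇒m≤1+n i≤N))) (f≡h (s≤s z≤n) ≤-refl)

sumFrom1-0 : ∀ N → sumFrom1 N (λ _ → 0) ≡ 0
sumFrom1-0 zero    = refl
sumFrom1-0 (suc N) = cong (_+ 0) (sumFrom1-0 N)

sumFrom1-+ : ∀ N (f h : ℕ → ℕ) → sumFrom1 N (λ i → f i + h i) ≡ sumFrom1 N f + sumFrom1 N h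
sumFrom1-+ zero    f h = refl
sumFrom1-+ (suc N) f h =
  trans (cong (_+ (f (suc N) + h (suc N))) (sumFrom1-+ N f h))
        (interchange (sumFrom1 N f) (sumFrom1 N h) (f (suc N)) (h (suc N)))

sumFrom1-*ˡ : ∀ N c (f : ℕ → ℕ) → sumFrom1 N (λ i → c * f i) ≡ c * sumFrom1 N f
sumFrom1-*ˡ zero    c f = sym (*-zeroʳ c)
sumFrom1-*ˡ (suc N) c f =
  trans (cong (_+ c * f (suc N)) (sumFrom1-*ˡ N c f)) (sym (*-distribˡ-+ c _ _))

sumFrom1-linear : ∀ N c (f h : ℕ → ℕ) →
  sumFrom1 N (λ i → c * f i + h i) ≡ c * sumFrom1 N f + sumFrom1 N h
sumFrom1-linear N c f h =
  trans (sumFrom1-+ N (λ i → c * f i) h) (cong (_+ sumFrom1 N h) (sumFrom1-*ˡ N c f))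

sumFrom1-indicator : ∀ N {c} v → 1 ≤ c → c ≤ N →
  sumFrom1 N (λ i → if does (c ≟ i) then v else 0) ≡ v
sumFrom1-indicator zero    v 1≤c c≤0 = contradiction c≤0 (<⇒≱ 1≤c)
sumFrom1-indicator (suc N) {c} v 1≤c c≤1+N with m≤n⇒m<n∨m≡n c≤1+N
... | inj₁ c<1+N rewrite dec-false (c ≟ suc N) (λ c≡1+N → <-irrefl c≡1+N c<1+N) =
  trans (+-identityʳ _) (sumFrom1-indicator N v 1≤c (s≤s⁻¹ c<1+N))
... | inj₂ refl rewrite dec-true (suc N ≟ suc N) refl =
  cong (_+ v) (trans (sumFrom1-cong N off-diagonal) (sumFrom1-0 N))
  where
  off-diagonal : ∀ {i} → 1 ≤ i → i ≤ N → (if does (suc N ≟ i) then v else 0) ≡ 0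
  off-diagonal {i} _ i≤N rewrite dec-false (suc N ≟ i) (λ { refl → n≮n N i≤N }) = refl

sumFrom1-shift : ∀ K (h : ℕ → ℕ) → sumFrom1 (suc K) h ≡ h 1 + sumFrom1 K (λ i → h (suc i))
sumFrom1-shift zero    h = +-comm 0 (h 1)
sumFrom1-shift (suc K) h = trans (cong (_+ h (suc (suc K))) (sumFrom1-shift K h)) (+-assoc (h 1) _ _)

sumFrom1-reverse : ∀ K (f : ℕ → ℕ) → sumFrom1 K f ≡ sumFrom1 K (λ ν → f (suc K ∸ ν))
sumFrom1-reverse zero    f = refl
sumFrom1-reverse (suc K) f = begin
  sumFrom1 K f + f (suc K)                      ≡⟨ cong (_+ f (suc K)) (sumFrom1-reverse K f) ⟩
  sumFrom1 K (λ ν → f (suc K ∸ ν)) + f (suc K)  ≡⟨ +-comm _ (f (suc K)) ⟩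
  f (suc K) + sumFrom1 K (λ ν → f (suc K ∸ ν))  ≡⟨ sumFrom1-shift K (λ ν → f (suc (suc K) ∸ ν)) ⟨
  sumFrom1 (suc K) (λ ν → f (suc (suc K) ∸ ν))  ∎
  where open ≡-Reasoning

sumFrom1-antidiagonal : ∀ K (F : ℕ → ℕ → ℕ) →
  sumFrom1 (suc K) (λ j → F j (suc K ∸ j)) ≡ F (suc K) 0 + sumFrom1 K (λ ν → F (suc K ∸ ν) ν)
sumFrom1-antidiagonal K F = begin
  sumFrom1 K (λ j → F j (suc K ∸ j)) + F (suc K) (K ∸ K)
    ≡⟨ cong₂ _+_ (sumFrom1-reverse K (λ j → F j (suc K ∸ j))) (cong (F (suc K)) (n∸n≡0 K)) ⟩
  sumFrom1 K (λ ν → F (suc K ∸ ν) (suc K ∸ (suc K ∸ ν))) + F (suc K) 0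
    ≡⟨ cong (_+ F (suc K) 0) (sumFrom1-cong K (λ _ ν≤K → cong (F _) (m∸[m∸n]≡n (m≤n⇒m≤1+n ν≤K)))) ⟩
  sumFrom1 K (λ ν → F (suc K ∸ ν) ν) + F (suc K) 0
    ≡⟨ +-comm _ (F (suc K) 0) ⟩
  F (suc K) 0 + sumFrom1 K (λ ν → F (suc K ∸ ν) ν) ∎
  where open ≡-Reasoning

sum-map-byKey : ∀ {A : Set} (key g : A → ℕ) N (xs : List A) →
  All (λ x → 1 ≤ key x × key x ≤ N) xs →
  sum (map g xs) ≡ sumFrom1 N (λ i → sum (map g (filter (λ x → key x ≟ i) xs)))
sum-map-byKey key g N []       []                         = sym (sumFrom1-0 N)
sum-map-byKey key g N (x ∷ xs) ((1≤key , key≤N) ∷ bounds) = begin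
  g x + sum (map g xs)
    ≡⟨ cong₂ _+_ (sym (sumFrom1-indicator N (g x) 1≤key key≤N)) (sum-map-byKey key g N xs bounds) ⟩
  sumFrom1 N (λ i → if does (key x ≟ i) then g x else 0) + sumFrom1 N (λ i → block i xs)
    ≡⟨ sumFrom1-+ N _ _ ⟨
  sumFrom1 N (λ i → (if does (key x ≟ i) then g x else 0) + block i xs)
    ≡⟨ sumFrom1-cong N (λ {i} _ _ → block-∷ i) ⟩
  sumFrom1 N (λ i → block i (x ∷ xs)) ∎
  where
  open ≡-Reasoning
  block : ℕ → List _ → ℕ
  block i ys = sum (map g (filter (λ y → key y ≟ i) ys))
  block-∷ : ∀ i → (if does (key x ≟ i) then g x else 0) + block i xs ≡ block i (x ∷ xs)
  block-∷ i with does (key x ≟ i)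
  ... | true  = refl
  ... | false = refl

sum-map-const : ∀ {A : Set} (g : A → ℕ) {c} (xs : List A) → All (λ x → g x ≡ c) xs →
  sum (map g xs) ≡ c * length xs
sum-map-const g {c} []       []          = sym (*-zeroʳ c)
sum-map-const g {c} (x ∷ xs) (gx≡c ∷ gxs≡c) =
  trans (cong₂ _+_ gx≡c (sum-map-const g xs gxs≡c)) (sym (*-suc c (length xs)))

-- Partitions as weakly decreasing lists

data Partition≤ (M : ℕ) : List ℕ → Set where
  []  : Partition≤ M []
  _∷_ : ∀ {x xs} → 0 < x × x ≤ M → Partition≤ x xs → Partition≤ M (x ∷ xs)

Partition≤-sum : ∀ {M xs} → Partition≤ M xs → Partition≤ (sum xs) xs
Partition≤-sum []                               = []
Partition≤-sum {xs = x ∷ xs} ((0<x , _) ∷ rest) = (0<x , m≤m+n x (sum xs)) ∷ rest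

private
  ∈-if⁺ˡ : ∀ {A : Set} {b} {x : A} {xs ys} → T b → x ∈ xs → x ∈ (if b then xs ++ ys else ys)
  ∈-if⁺ˡ {b = true} _ x∈xs = ∈-++⁺ˡ x∈xs

  ∈-if⁺ʳ : ∀ {A : Set} b {x : A} {xs ys} → x ∈ ys → x ∈ (if b then xs ++ ys else ys)
  ∈-if⁺ʳ true  {xs = xs} x∈ys = ∈-++⁺ʳ xs x∈ys
  ∈-if⁺ʳ false           x∈ys = x∈ys

  ∈-if⁻ : ∀ {A : Set} b {x : A} {xs ys} → x ∈ (if b then xs ++ ys else ys) → (T b × x ∈ xs) ⊎ x ∈ ys
  ∈-if⁻ true  {xs = xs} x∈ with ∈-++⁻ xs x∈
  ... | inj₁ x∈xs = inj₁ (tt , x∈xs)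
  ... | inj₂ x∈ys = inj₂ x∈ys
  ∈-if⁻ false x∈ys = inj₂ x∈ys

  Unique-if : ∀ {A : Set} b {xs ys : List A} → Unique xs → Unique ys →
    (∀ {x} → x ∈ xs → x ∈ ys → ⊥) → Unique (if b then xs ++ ys else ys)
  Unique-if true  xs! ys! disjoint = Unique.++⁺ xs! ys! (λ (x∈xs , x∈ys) → disjoint x∈xs x∈ys)
  Unique-if false _   ys! _        = ys!

partsStartingWith : ℕ → ℕ → ℕ → ℕ → List (List ℕ)
partsStartingWith f n k j = map (suc j ∷_) (partsAtMost f (n ∸ j) k (suc j))

-- partsAtMost recurses on its bound through a local list of candidate first parts; this is one
-- step of that recursion, with the candidate first part suc i.
partsAtMost-suc : ∀ f n k i → partsAtMost (suc f) (suc n) (suc k) (suc i) ≡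
  (if suc i ≤ᵇ suc n then partsStartingWith f n k i ++ partsAtMost (suc f) (suc n) (suc k) i
                      else partsAtMost (suc f) (suc n) (suc k) i)
partsAtMost-suc f n k i = concatMap-if (suc i ≤ᵇ suc n)
  where
  concatMap-if : ∀ b {xs} → concatMap (partsStartingWith f n k) (if b then i ∷ xs else xs) ≡
                 (if b then partsStartingWith f n k i ++ concatMap (partsStartingWith f n k) xs
                       else concatMap (partsStartingWith f n k) xs)
  concatMap-if true  = refl
  concatMap-if false = refl

∈-partsAtMost-suc⁻ : ∀ {f n k} M {xs} → xs ∈ partsAtMost (suc f) (suc n) (suc k) M →
  ∃₂ λ j rest → xs ≡ suc j ∷ rest × j < M × j ≤ n × rest ∈ partsAtMost f (n ∸ j) k (suc j)
∈-partsAtMost-suc⁻ {f} {n} {k} (suc i) xs∈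
  with ∈-if⁻ (suc i ≤ᵇ suc n) (subst (_ ∈_) (partsAtMost-suc f n k i) xs∈)
... | inj₁ (i<1+n , xs∈block) with ∈-map⁻ (suc i ∷_) xs∈block
...   | rest , rest∈ , refl = i , rest , refl , ≤-refl , s≤s⁻¹ (≤ᵇ⇒≤ (suc i) (suc n) i<1+n) , rest∈
∈-partsAtMost-suc⁻ (suc i) xs∈ | inj₂ xs∈rec with ∈-partsAtMost-suc⁻ i xs∈rec
...   | j , rest , xs≡ , j<i , j≤n , rest∈ = j , rest , xs≡ , m≤n⇒m≤1+n j<i , j≤n , rest∈

∈-partsAtMost-suc⁺ : ∀ {f n k} M {j rest} → j < M → j ≤ n → rest ∈ partsAtMost f (n ∸ j) k (suc j) →
  suc j ∷ rest ∈ partsAtMost (suc f) (suc n) (suc k) M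
∈-partsAtMost-suc⁺ {f} {n} {k} (suc i) j<1+i j≤n rest∈ rewrite partsAtMost-suc f n k i
  with m≤n⇒m<n∨m≡n (s≤s⁻¹ j<1+i)
... | inj₁ j<i  = ∈-if⁺ʳ (suc i ≤ᵇ suc n) (∈-partsAtMost-suc⁺ i j<i j≤n rest∈)
... | inj₂ refl = ∈-if⁺ˡ (≤⇒≤ᵇ (s≤s j≤n)) (∈-map⁺ (suc i ∷_) rest∈)

∈-partsAtMost⁻ : ∀ f n k M {xs} → xs ∈ partsAtMost f n k M →
  Partition≤ M xs × length xs ≡ k × sum xs ≡ n
∈-partsAtMost⁻ f       zero    zero    M (here refl) = [] , refl , refl
∈-partsAtMost⁻ (suc f) (suc n) (suc k) M xs∈ with ∈-partsAtMost-suc⁻ M xs∈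
... | j , rest , refl , j<M , j≤n , rest∈ with ∈-partsAtMost⁻ f (n ∸ j) k (suc j) rest∈
...   | rest-part , length≡ , sum≡ =
  ((s≤s z≤n , j<M) ∷ rest-part) , cong suc length≡ , cong suc (trans (cong (j +_) sum≡) (m+[n∸m]≡n j≤n))

∈-partsAtMost⁺ : ∀ f n k M {xs} → n ≤ f → Partition≤ M xs → length xs ≡ k → sum xs ≡ n →
  xs ∈ partsAtMost f n k M
∈-partsAtMost⁺ f       _       _       M _ [] refl refl = here refl
∈-partsAtMost⁺ f       n       k       M {zero ∷ _} _ ((() , _) ∷ _) _ _
∈-partsAtMost⁺ f       n       zero    M {suc _ ∷ _} _ (_ ∷ _) () _
∈-partsAtMost⁺ f       zero    (suc k) M {suc _ ∷ _} _ (_ ∷ _) _ ()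
∈-partsAtMost⁺ zero    (suc n) (suc k) M {suc _ ∷ _} () (_ ∷ _) _ _
∈-partsAtMost⁺ (suc f) (suc n) (suc k) M {suc j ∷ rest}
  (s≤s n≤f) ((_ , j<M) ∷ rest-part) length≡ sum≡ =
  ∈-partsAtMost-suc⁺ M j<M j≤n
    (∈-partsAtMost⁺ f (n ∸ j) k (suc j) (≤-trans (m∸n≤m n j) n≤f) rest-part
                    (suc-injective length≡) rest-sum)
  where
  j+rest≡n : j + sum rest ≡ n
  j+rest≡n = suc-injective sum≡
  j≤n : j ≤ n
  j≤n = subst (j ≤_) j+rest≡n (m≤m+n j (sum rest))
  rest-sum : sum rest ≡ n ∸ j
  rest-sum = trans (sym (m+n∸m≡n j (sum rest))) (cong (_∸ j) j+rest≡n)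

partsAtMost-unique : ∀ f n k M → Unique (partsAtMost f n k M)
partsAtMost-unique f       zero    zero    M       = [] ∷ []
partsAtMost-unique f       zero    (suc k) M       = []
partsAtMost-unique f       (suc n) zero    M       = []
partsAtMost-unique zero    (suc n) (suc k) M       = []
partsAtMost-unique (suc f) (suc n) (suc k) zero    = []
partsAtMost-unique (suc f) (suc n) (suc k) (suc i) =
  subst Unique (sym (partsAtMost-suc f n k i))
    (Unique-if (suc i ≤ᵇ suc n)
      (Unique.map⁺ ∷-injectiveʳ (partsAtMost-unique f (n ∸ i) k (suc i)))
      (partsAtMost-unique (suc f) (suc n) (suc k) i)
      disjoint)
  where
  disjoint : ∀ {xs} → xs ∈ partsStartingWith f n k i → xs ∈ partsAtMost (suc f) (suc n) (suc k) i → ⊥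
  disjoint xs∈block xs∈rec with ∈-map⁻ (suc i ∷_) xs∈block | ∈-partsAtMost⁻ (suc f) (suc n) (suc k) i xs∈rec
  ... | _ , _ , refl | ((_ , 1+i≤i) ∷ _) , _ = n≮n i 1+i≤i

∈-Partitions⁻ : ∀ {n k xs} → xs ∈ Partitions n k → Partition≤ n xs × length xs ≡ k × sum xs ≡ n
∈-Partitions⁻ {n} {k} = ∈-partsAtMost⁻ n n k n

∈-Partitions⁺ : ∀ {M n k xs} → Partition≤ M xs → length xs ≡ k → sum xs ≡ n → xs ∈ Partitions n k
∈-Partitions⁺ {n = n} {k} {xs} part length≡ sum≡ =
  ∈-partsAtMost⁺ n n k n ≤-refl (subst (λ s → Partition≤ s xs) sum≡ (Partition≤-sum part)) length≡ sum≡

Partitions-unique : ∀ n k → Unique (Partitions n k)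
Partitions-unique n k = partsAtMost-unique n n k n

partitionCount : ℕ → ℕ → ℕ
partitionCount n k = length (Partitions n k)

-- The smallest part

σ-≤-parts : ∀ {M xs} → Partition≤ M xs → All (σ xs ≤_) xs
σ-≤-parts []                       = []
σ-≤-parts (_ ∷ [])                 = ≤-refl ∷ []
σ-≤-parts (_ ∷ tail@((_ , y≤x) ∷ _)) with σ-≤-parts tail
... | σ≤y ∷ σ≤rest = ≤-trans σ≤y y≤x ∷ σ≤y ∷ σ≤rest

σ-pos : ∀ {M x xs} → Partition≤ M (x ∷ xs) → 0 < σ (x ∷ xs)
σ-pos ((0<x , _) ∷ [])   = 0<x
σ-pos (_ ∷ tail@(_ ∷ _)) = σ-pos tail

#-pos : ∀ x xs → 0 < # (x ∷ xs)
#-pos x [] rewrite dec-true (x ≟ x) refl = ≤-refl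
#-pos x (y ∷ ys) = ≤-trans (#-pos y ys) (m≤n+m (# (y ∷ ys)) (if x ≡ᵇ σ (y ∷ ys) then 1 else 0))

countEq-≤-length : ∀ a xs → countEq a xs ≤ length xs
countEq-≤-length a []       = z≤n
countEq-≤-length a (x ∷ xs) with x ≡ᵇ a
... | true  = s≤s (countEq-≤-length a xs)
... | false = m≤n⇒m≤1+n (countEq-≤-length a xs)

length*≤sum : ∀ {m} xs → All (m ≤_) xs → length xs * m ≤ sum xs
length*≤sum []       []             = z≤n
length*≤sum (x ∷ xs) (m≤x ∷ m≤xs) = +-mono-≤ m≤x (length*≤sum xs m≤xs)

withSmallest : ℕ → ℕ → List ℕ → List ℕ
withSmallest m j μ = map (_+ m) μ ++ replicate j m

length-withSmallest : ∀ m j μ → length (withSmallest m j μ) ≡ length μ + j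
length-withSmallest m j μ =
  trans (length-++ (map (_+ m) μ)) (cong₂ _+_ (length-map (_+ m) μ) (length-replicate j))

sum-withSmallest : ∀ m j μ → sum (withSmallest m j μ) ≡ sum μ + (length μ + j) * m
sum-withSmallest m zero    []      = refl
sum-withSmallest m (suc j) []      = cong (m +_) (sum-withSmallest m j [])
sum-withSmallest m j       (x ∷ μ) =
  trans (cong (x + m +_) (sum-withSmallest m j μ)) (interchange x m (sum μ) ((length μ + j) * m))

Partition≤-replicate : ∀ {M m} j → 0 < m → m ≤ M → Partition≤ M (replicate j m)
Partition≤-replicate zero    _   _   = []
Partition≤-replicate (suc j) 0<m m≤M = (0<m , m≤M) ∷ Partition≤-replicate j 0<m ≤-refl

Partition≤-withSmallest : ∀ {M m μ} j → 0 < m → Partition≤ M μ → Partition≤ (M + m) (withSmallest m j μ)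
Partition≤-withSmallest {M} {m} j 0<m []                 = Partition≤-replicate j 0<m (m≤n+m m M)
Partition≤-withSmallest {m = m} {x ∷ _} j 0<m ((0<x , x≤M) ∷ rest) =
  (<-≤-trans 0<x (m≤m+n x m) , +-monoˡ-≤ m x≤M) ∷ Partition≤-withSmallest j 0<m rest

σ-withSmallest : ∀ m {j} μ → 0 < j → σ (withSmallest m j μ) ≡ m
σ-withSmallest m {suc j} μ _ = lastOr-withSmallest 0 μ
  where
  lastOr-replicate : ∀ i → lastOr m (replicate i m) ≡ m
  lastOr-replicate zero    = refl
  lastOr-replicate (suc i) = lastOr-replicate i
  lastOr-withSmallest : ∀ d μ → lastOr d (withSmallest m (suc j) μ) ≡ m
  lastOr-withSmallest d []      = lastOr-replicate j
  lastOr-withSmallest d (x ∷ μ) = lastOr-withSmallest (x + m) μ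

countEq-replicate : ∀ m j → countEq m (replicate j m) ≡ j
countEq-replicate m zero                                   = refl
countEq-replicate m (suc j) rewrite dec-true (m ≟ m) refl = cong suc (countEq-replicate m j)

countEq-withSmallest : ∀ {M} m j {μ} → Partition≤ M μ → countEq m (withSmallest m j μ) ≡ j
countEq-withSmallest m j [] = countEq-replicate m j
countEq-withSmallest m j {suc x ∷ _} (_ ∷ rest)
  rewrite dec-false (suc x + m ≟ m) (λ eq → m≢1+n+m m (sym eq)) = countEq-withSmallest m j rest

#-withSmallest : ∀ {M} m {j μ} → 0 < j → Partition≤ M μ → # (withSmallest m j μ) ≡ j
#-withSmallest m {j} {μ} 0<j part =
  trans (cong (λ s → countEq s (withSmallest m j μ)) (σ-withSmallest m μ 0<j))
        (countEq-withSmallest m j part)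

withSmallest-injective : ∀ m j {μ μ′} → withSmallest m j μ ≡ withSmallest m j μ′ → μ ≡ μ′
withSmallest-injective m j {μ} {μ′} eq =
  map-injective (+-cancelʳ-≡ m _ _) (++-cancelʳ (replicate j m) (map (_+ m) μ) (map (_+ m) μ′) eq)

Partition≤⇒≡withSmallest : ∀ {M x xs} → Partition≤ M (x ∷ xs) →
  ∃ λ μ → Partition≤ (M ∸ σ (x ∷ xs)) μ × x ∷ xs ≡ withSmallest (σ (x ∷ xs)) (# (x ∷ xs)) μ
Partition≤⇒≡withSmallest {x = x} (_ ∷ []) rewrite dec-true (x ≟ x) refl = [] , [] , refl
Partition≤⇒≡withSmallest {M} {x} {y ∷ ys} part@((_ , x≤M) ∷ tail@((_ , y≤x) ∷ _))
  with Partition≤⇒≡withSmallest tail | x ≟ σ (y ∷ ys)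
... | μ , μ-part , y∷ys≡ | yes x≡s rewrite dec-true (x ≟ σ (y ∷ ys)) x≡s =
  [] , [] , cong₂ _∷_ x≡s (subst (λ μ → y ∷ ys ≡ withSmallest s j μ) (no-larger-parts μ-part y∷ys≡) y∷ys≡)
  where
  s = σ (y ∷ ys)
  j = # (y ∷ ys)
  no-larger-parts : ∀ {B μ} → Partition≤ B μ → y ∷ ys ≡ withSmallest s j μ → μ ≡ []
  no-larger-parts []                   _     = refl
  no-larger-parts (_∷_ {z} (0<z , _) _) y∷ys≡ =
    contradiction (subst (z + s ≤_) x≡s (subst (_≤ x) (∷-injectiveˡ y∷ys≡) y≤x)) (<⇒≱ (+-monoˡ-< s 0<z))
... | μ , μ-part , y∷ys≡ | no x≢s rewrite dec-false (x ≟ σ (y ∷ ys)) x≢s =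
  (x ∸ s) ∷ μ , (m<n⇒0<n∸m s<x , ∸-monoˡ-≤ s x≤M) ∷ μ-part , cong₂ _∷_ (sym (m∸n+n≡m (<⇒≤ s<x))) y∷ys≡
  where
  s = σ (y ∷ ys)
  s<x : s < x
  s<x = ≤∧≢⇒< (All.head (σ-≤-parts part)) (≢-sym x≢s)

withSmallest-∈⁻ : ∀ {B m j μ n k} → Partition≤ B μ → withSmallest m j μ ∈ Partitions n k →
  μ ∈ Partitions (n ∸ k * m) (k ∸ j)
withSmallest-∈⁻ {m = m} {j} {μ} {n} {k} μ-part ws∈ with ∈-Partitions⁻ ws∈
... | _ , length≡ , sum≡ = ∈-Partitions⁺ μ-part length-μ sum-μ
  where
  k≡ : length μ + j ≡ k
  k≡ = trans (sym (length-withSmallest m j μ)) length≡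
  length-μ : length μ ≡ k ∸ j
  length-μ = trans (sym (m+n∸n≡m (length μ) j)) (cong (_∸ j) k≡)
  sum-μ : sum μ ≡ n ∸ k * m
  sum-μ = begin
    sum μ                           ≡⟨ m+n∸n≡m (sum μ) (k * m) ⟨
    sum μ + k * m ∸ k * m            ≡⟨ cong (λ l → sum μ + l * m ∸ k * m) k≡ ⟨
    sum μ + (length μ + j) * m ∸ k * m ≡⟨ cong (_∸ k * m) (trans (sym (sum-withSmallest m j μ)) sum≡) ⟩
    n ∸ k * m                       ∎
    where open ≡-Reasoning

withSmallest-∈⁺ : ∀ {m j μ n k} → 0 < m → j ≤ k → k * m ≤ n → μ ∈ Partitions (n ∸ k * m) (k ∸ j) →
  withSmallest m j μ ∈ Partitions n k
withSmallest-∈⁺ {m} {j} {μ} {n} {k} 0<m j≤k km≤n μ∈ with ∈-Partitions⁻ μ∈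
... | μ-part , length≡ , sum≡ =
  ∈-Partitions⁺ (Partition≤-withSmallest j 0<m μ-part) length-ws sum-ws
  where
  k≡ : length μ + j ≡ k
  k≡ = trans (cong (_+ j) length≡) (m∸n+n≡m j≤k)
  length-ws : length (withSmallest m j μ) ≡ k
  length-ws = trans (length-withSmallest m j μ) k≡
  sum-ws : sum (withSmallest m j μ) ≡ n
  sum-ws = begin
    sum (withSmallest m j μ)    ≡⟨ sum-withSmallest m j μ ⟩
    sum μ + (length μ + j) * m  ≡⟨ cong₂ (λ s l → s + l * m) sum≡ k≡ ⟩
    n ∸ k * m + k * m           ≡⟨ m∸n+n≡m km≤n ⟩
    n                           ∎
    where open ≡-Reasoning

∈-Partitions⇒≡withSmallest : ∀ {n k xs} → xs ∈ Partitions n k →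
  ∃ λ μ → μ ∈ Partitions (n ∸ k * σ xs) (k ∸ # xs) × xs ≡ withSmallest (σ xs) (# xs) μ
∈-Partitions⇒≡withSmallest {k = k} {[]} []∈ rewrite *-zeroʳ k = [] , []∈ , refl
∈-Partitions⇒≡withSmallest {n} {k} {_ ∷ _} xs∈
  with Partition≤⇒≡withSmallest (proj₁ (∈-Partitions⁻ {n} {k} xs∈))
... | μ , μ-part , xs≡ = μ , withSmallest-∈⁻ {n = n} {k} μ-part (subst (_∈ Partitions n k) xs≡ xs∈) , xs≡

-- Sorting partitions by smallest part and its multiplicity

PartitionsBySmallest : ℕ → ℕ → ℕ → ℕ → List (List ℕ)
PartitionsBySmallest n k m j = filter (λ xs → # xs ≟ j) (filter (λ xs → σ xs ≟ m) (Partitions n k))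

length-PartitionsBySmallest : ∀ {n k m j} → 0 < m → 0 < j → j ≤ k → k * m ≤ n →
  length (PartitionsBySmallest n k m j) ≡ partitionCount (n ∸ k * m) (k ∸ j)
length-PartitionsBySmallest {n} {k} {m} {j} 0<m 0<j j≤k km≤n =
  trans (↭-length (∼bag⇒↭ (unique∧set⇒bag unique-filtered unique-image (mk⇔ to from))))
        (length-map (withSmallest m j) (Partitions (n ∸ k * m) (k ∸ j)))
  where
  image : List (List ℕ)
  image = map (withSmallest m j) (Partitions (n ∸ k * m) (k ∸ j))
  unique-filtered : Unique (PartitionsBySmallest n k m j)
  unique-filtered = Unique.filter⁺ _ (Unique.filter⁺ _ (Partitions-unique n k))
  unique-image : Unique image
  unique-image = Unique.map⁺ (withSmallest-injective m j) (Partitions-unique (n ∸ k * m) (k ∸ j))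
  to : ∀ {xs} → xs ∈ PartitionsBySmallest n k m j → xs ∈ image
  to xs∈ with ∈-filter⁻ (λ xs → # xs ≟ j) xs∈
  ... | xs∈′ , refl with ∈-filter⁻ (λ xs → σ xs ≟ m) xs∈′
  ...   | xs∈Partitions , refl with ∈-Partitions⇒≡withSmallest {n} {k} xs∈Partitions
  ...     | μ , μ∈ , xs≡ = subst (_∈ image) (sym xs≡) (∈-map⁺ (withSmallest m j) μ∈)
  from : ∀ {xs} → xs ∈ image → xs ∈ PartitionsBySmallest n k m j
  from xs∈ with ∈-map⁻ (withSmallest m j) xs∈
  ... | μ , μ∈ , refl =
    ∈-filter⁺ (λ xs → # xs ≟ j)
      (∈-filter⁺ (λ xs → σ xs ≟ m) (withSmallest-∈⁺ {n = n} {k} 0<m j≤k km≤n μ∈) (σ-withSmallest m μ 0<j))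
      (#-withSmallest m 0<j (proj₁ (∈-Partitions⁻ {n ∸ k * m} {k ∸ j} μ∈)))

∈-Partitions⇒σ-bounds : ∀ {n k xs} .{{_ : NonZero k}} → xs ∈ Partitions n k →
  1 ≤ σ xs × σ xs ≤ n / k
∈-Partitions⇒σ-bounds {n} {k} {xs} xs∈ with ∈-Partitions⁻ {n} {k} xs∈
∈-Partitions⇒σ-bounds {k = k} {[]}    _ | _ , refl , _ = contradiction (>-nonZero⁻¹ k) (n≮n 0)
∈-Partitions⇒σ-bounds {n} {k} {xs@(_ ∷ _)} _ | part , length≡ , sum≡ = σ-pos part , σ≤n/k
  where
  kσ≤n : k * σ xs ≤ n
  kσ≤n = subst₂ (λ l s → l * σ xs ≤ s) length≡ sum≡ (length*≤sum xs (σ-≤-parts part))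
  σ≤n/k : σ xs ≤ n / k
  σ≤n/k = subst (_≤ n / k) (m*n/n≡m (σ xs) k) (/-monoˡ-≤ k (subst (_≤ n) (*-comm k (σ xs)) kσ≤n))

∈-Partitions⇒#-bounds : ∀ {n k xs} .{{_ : NonZero k}} → xs ∈ Partitions n k →
  1 ≤ # xs × # xs ≤ k
∈-Partitions⇒#-bounds {n} {k} {xs} xs∈ with ∈-Partitions⁻ {n} {k} xs∈
∈-Partitions⇒#-bounds {k = k} {[]}    _ | _ , refl , _ = contradiction (>-nonZero⁻¹ k) (n≮n 0)
∈-Partitions⇒#-bounds {xs = x ∷ xs} _ | _ , length≡ , _ =
  #-pos x xs , subst (# (x ∷ xs) ≤_) length≡ (countEq-≤-length (σ (x ∷ xs)) (x ∷ xs))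

spt-bySmallestPart : ∀ a b n k .{{_ : NonZero k}} →
  spt a b n k ≡
  sumFrom1 (n / k) (λ m → m ^ a * sumFrom1 k (λ j → j ^ b * partitionCount (n ∸ k * m) (k ∸ j)))
spt-bySmallestPart a b n k = begin
  sum (map weight (Partitions n k))
    ≡⟨ sum-map-byKey σ weight (n / k) (Partitions n k) (All.tabulate (∈-Partitions⇒σ-bounds {n} {k})) ⟩
  sumFrom1 (n / k) (λ m → sum (map weight (filter (λ xs → σ xs ≟ m) (Partitions n k))))
    ≡⟨ sumFrom1-cong (n / k) smallest-part-block ⟩
  sumFrom1 (n / k) (λ m → m ^ a * sumFrom1 k (λ j → j ^ b * partitionCount (n ∸ k * m) (k ∸ j))) ∎
  where
  open ≡-Reasoning
  weight : List ℕ → ℕ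
  weight xs = σ xs ^ a * # xs ^ b

  weight-PartitionsBySmallest : ∀ m j →
    All (λ xs → weight xs ≡ m ^ a * j ^ b) (PartitionsBySmallest n k m j)
  weight-PartitionsBySmallest m j = All.tabulate λ xs∈ →
    let xs∈′ , #≡j = ∈-filter⁻ (λ xs → # xs ≟ j) {xs = filter (λ xs → σ xs ≟ m) (Partitions n k)} xs∈
        _    , σ≡m = ∈-filter⁻ (λ xs → σ xs ≟ m) {xs = Partitions n k} xs∈′
    in cong₂ (λ s c → s ^ a * c ^ b) σ≡m #≡j

  smallest-part-block : ∀ {m} → 1 ≤ m → m ≤ n / k →
    sum (map weight (filter (λ xs → σ xs ≟ m) (Partitions n k))) ≡
    m ^ a * sumFrom1 k (λ j → j ^ b * partitionCount (n ∸ k * m) (k ∸ j))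
  smallest-part-block {m} 1≤m m≤n/k = begin
    sum (map weight (filter (λ xs → σ xs ≟ m) (Partitions n k)))
      ≡⟨ sum-map-byKey # weight k (filter (λ xs → σ xs ≟ m) (Partitions n k))
           (All.filter⁺ (λ xs → σ xs ≟ m) (All.tabulate (∈-Partitions⇒#-bounds {n} {k}))) ⟩
    sumFrom1 k (λ j → sum (map weight (PartitionsBySmallest n k m j)))
      ≡⟨ sumFrom1-cong k multiplicity-block ⟩
    sumFrom1 k (λ j → m ^ a * (j ^ b * partitionCount (n ∸ k * m) (k ∸ j)))
      ≡⟨ sumFrom1-*ˡ k (m ^ a) _ ⟩
    m ^ a * sumFrom1 k (λ j → j ^ b * partitionCount (n ∸ k * m) (k ∸ j)) ∎
    where
    km≤n : k * m ≤ n
    km≤n = ≤-trans (*-monoʳ-≤ k m≤n/k) (subst (_≤ n) (*-comm (n / k) k) (m/n*n≤m n k))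
    multiplicity-block : ∀ {j} → 1 ≤ j → j ≤ k →
      sum (map weight (PartitionsBySmallest n k m j)) ≡
      m ^ a * (j ^ b * partitionCount (n ∸ k * m) (k ∸ j))
    multiplicity-block {j} 1≤j j≤k = begin
      sum (map weight (PartitionsBySmallest n k m j))
        ≡⟨ sum-map-const weight _ (weight-PartitionsBySmallest m j) ⟩
      m ^ a * j ^ b * length (PartitionsBySmallest n k m j)
        ≡⟨ cong (m ^ a * j ^ b *_) (length-PartitionsBySmallest 1≤m 1≤j j≤k km≤n) ⟩
      m ^ a * j ^ b * partitionCount (n ∸ k * m) (k ∸ j)
        ≡⟨ *-assoc (m ^ a) (j ^ b) _ ⟩
      m ^ a * (j ^ b * partitionCount (n ∸ k * m) (k ∸ j)) ∎

partitionCount-∸-0 : ∀ {m n} → m < n → partitionCount (n ∸ m) 0 ≡ 0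
partitionCount-∸-0 {m} {n} m<n with n ∸ m | m<n⇒0<n∸m m<n
... | suc _ | _ = refl

-- Only the last term can be nonzero, and it is 1 exactly when k q = n.
sumFrom1-partitionCount-0 : ∀ n k q .{{_ : NonZero n}} → 0 < k → k * q ≤ n →
  sumFrom1 q (λ m → partitionCount (n ∸ k * m) 0) ≡ (k * q) / n
sumFrom1-partitionCount-0 n k zero    _   _    =
  sym (trans (cong (_/ n) (*-zeroʳ k)) (m<n⇒m/n≡0 (>-nonZero⁻¹ n)))
sumFrom1-partitionCount-0 n k (suc q) 0<k kq≤n =
  cong₂ _+_ (trans (sumFrom1-cong q (λ _ m≤q → partitionCount-∸-0 (km<n m≤q))) (sumFrom1-0 q))
            (last-term (m≤n⇒m<n∨m≡n kq≤n))
  where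
  km<n : ∀ {m} → m ≤ q → k * m < n
  km<n m≤q = <-≤-trans (*-monoʳ-< k {{>-nonZero 0<k}} (s≤s m≤q)) kq≤n
  last-term : k * suc q < n ⊎ k * suc q ≡ n → partitionCount (n ∸ k * suc q) 0 ≡ (k * suc q) / n
  last-term (inj₁ kq<n) = trans (partitionCount-∸-0 kq<n) (sym (m<n⇒m/n≡0 kq<n))
  last-term (inj₂ kq≡n) rewrite kq≡n = trans (cong (λ r → partitionCount r 0) (n∸n≡0 n)) (sym (n/n≡1 n))

-- p r ν agrees with partitionCount r ν except for p 0 1 = 1 ≠ 0 = partitionCount 0 1, and
-- partitionCount r 0 is 1 if r = 0 and 0 otherwise.
sumFrom1-p : ∀ K (w : ℕ → ℕ) r →
  sumFrom1 (suc K) (λ ν → w ν * p r ν) ≡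
  w 1 * partitionCount r 0 + sumFrom1 (suc K) (λ ν → w ν * partitionCount r ν)
sumFrom1-p K w (suc r) =
  cong (_+ sumFrom1 (suc K) (λ ν → w ν * partitionCount (suc r) ν)) (sym (*-zeroʳ (w 1)))
sumFrom1-p K w zero = begin
  sumFrom1 (suc K) (λ ν → w ν * p 0 ν)
    ≡⟨ sumFrom1-shift K (λ ν → w ν * p 0 ν) ⟩
  w 1 * 1 + sumFrom1 K (λ i → w (suc i) * p 0 (suc i))
    ≡⟨ cong (w 1 * 1 +_) (sumFrom1-cong K λ { {suc _} _ _ → refl }) ⟩
  w 1 * 1 + rest
    ≡⟨ cong (λ z → w 1 * 1 + (z + rest)) (*-zeroʳ (w 1)) ⟨
  w 1 * 1 + (w 1 * 0 + rest)
    ≡⟨ cong (w 1 * 1 +_) (sumFrom1-shift K (λ ν → w ν * partitionCount 0 ν)) ⟨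
  w 1 * 1 + sumFrom1 (suc K) (λ ν → w ν * partitionCount 0 ν) ∎
  where
  open ≡-Reasoning
  rest : ℕ
  rest = sumFrom1 K (λ i → w (suc i) * partitionCount 0 (suc i))

-- The case K = 0 holds because the exponent suc b is positive; this is where 1 ≤ b is used.
sumFrom1-[k∸ν]^b*p : ∀ K b r →
  sumFrom1 K (λ ν → (suc K ∸ ν) ^ suc b * p r ν) ≡
  K ^ suc b * partitionCount r 0 + sumFrom1 K (λ ν → (suc K ∸ ν) ^ suc b * partitionCount r ν)
sumFrom1-[k∸ν]^b*p zero    b r = refl
sumFrom1-[k∸ν]^b*p (suc K) b r = sumFrom1-p K (λ ν → (suc (suc K) ∸ ν) ^ suc b) r

m*o+p≡o*[m∸n]+[n*o+p] : ∀ {m n} o p → n ≤ m → m * o + p ≡ o * (m ∸ n) + (n * o + p)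
m*o+p≡o*[m∸n]+[n*o+p] {m} {n} o p n≤m = begin
  m * o + p                     ≡⟨ cong (_+ p) (m∸n+n≡m (*-monoˡ-≤ o n≤m)) ⟨
  m * o ∸ n * o + n * o + p     ≡⟨ +-assoc (m * o ∸ n * o) (n * o) p ⟩
  m * o ∸ n * o + (n * o + p)   ≡⟨ cong (_+ (n * o + p)) (*-distribʳ-∸ o m n) ⟨
  (m ∸ n) * o + (n * o + p)     ≡⟨ cong (_+ (n * o + p)) (*-comm (m ∸ n) o) ⟩
  o * (m ∸ n) + (n * o + p)     ∎
  where open ≡-Reasoning

lemma8 : (n k b : ℕ) → .{{_ : NonZero n}} → .{{_ : NonZero k}} → 1 ≤ b →
    spt 0 b n k ≡ rhs8 n k b
lemma8 n k@(suc K) b@(suc b′) _ = begin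
  spt 0 b n k
    ≡⟨ spt-bySmallestPart 0 b n k ⟩
  sumFrom1 q (λ m → 1 * sumFrom1 k (λ j → j ^ b * partitionCount (r m) (k ∸ j)))
    ≡⟨ sumFrom1-cong q (λ {m} _ _ →
         trans (*-identityˡ _) (sumFrom1-antidiagonal K (λ j ν → j ^ b * partitionCount (r m) ν))) ⟩
  sumFrom1 q (λ m → k ^ b * empty m + A m)
    ≡⟨ sumFrom1-linear q (k ^ b) empty A ⟩
  k ^ b * Z + sumFrom1 q A
    ≡⟨ m*o+p≡o*[m∸n]+[n*o+p] Z (sumFrom1 q A) (^-monoˡ-≤ b (n≤1+n K)) ⟩
  Z * (k ^ b ∸ K ^ b) + (K ^ b * Z + sumFrom1 q A)
    ≡⟨ cong₂ (λ z s → z * (k ^ b ∸ K ^ b) + s) Z≡D (sym (sumFrom1-linear q (K ^ b) empty A)) ⟩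
  D * (k ^ b ∸ K ^ b) + sumFrom1 q (λ m → K ^ b * empty m + A m)
    ≡⟨ cong (D * (k ^ b ∸ K ^ b) +_) (sumFrom1-cong q (λ {m} _ _ → sumFrom1-[k∸ν]^b*p K b′ (r m))) ⟨
  rhs8 n k b ∎
  where
  open ≡-Reasoning
  q = n / k
  D = (k * q) / n
  r empty A : ℕ → ℕ
  r m     = n ∸ k * m
  empty m = partitionCount (r m) 0
  A m     = sumFrom1 K (λ ν → (k ∸ ν) ^ b * partitionCount (r m) ν)
  Z = sumFrom1 q empty
  Z≡D : Z ≡ D
  Z≡D = sumFrom1-partitionCount-0 n k q (s≤s z≤n) (subst (_≤ n) (*-comm q k) (m/n*n≤m n k))
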